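{- Let $k'\le k$ be positive integers. If $H$ is a $k$-uniform hypergraph with minimum degree at least $k'/2+1$ and girth at least $5$, then $H$ is $k'$-detectable.
   Context: A hypergraph is $k$-uniform if all hyperedges have cardinality $k$; the degree of a vertex is the number of hyperedges containing it. Girth is in the sense of Berge: a cycle of length $\ell\ge 2$ is a sequence of distinct vertices $v_1,\dots,v_\ell$ together with distinct hyperedges $e_1,\dots,e_\ell$ with $\{v_i,v_{i+1}\}\subseteq e_i$ for $1\le i\le \ell-1$ and $\{v_\ell,v_1\}\subseteq e_\ell$; the girth is the minimum length of a cycle. Hypergraph detection: for a hypergraph with hyperedges $h_1,\dots,h_g$ of cardinality at most $k$ and a set $B$ of $k'\le k$ vertices, the detection vector is $(p_1,\dots,p_g)$ with $p_i=0$ if $h_i\cap B=\emptyset$, $p_i=k$ if $|h_i\cap B|=k$, and $p_i=1$ otherwise. The hypergraph is $k'$-detectable if any two distinct $k'$-element vertex sets have distinct detection vectors. -}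

module Defs where

open import Data.Nat using (ℕ; zero; suc; _+_; _*_; _≤_; _<_)
open import Data.Nat.Properties using (_≟_)
open import Data.Fin using (Fin; zero; suc; inject₁; fromℕ)
open import Data.Fin.Subset using (Subset; _∈_; _∩_; ∣_∣; _⊆_)
open import Data.Fin.Subset.Properties using (_∈?_)
open import Data.Vec using (Vec; tabulate; count)
open import Data.Product using (Σ; _×_; _,_)
open import Function.Definitions using (Injective)
open import Relation.Binary.PropositionalEquality using (_≡_)
open import Relation.Nullary using (¬_; yes; no)

record Hypergraph (n g : ℕ) : Set where
  constructor hypergraph
  field
    edge : Fin g → Subset n
open Hypergraph public

Uniform : ∀ {n g} → ℕ → Hypergraph n g → Set
Uniform k H = ∀ i → ∣ edge H i ∣ ≡ k

degree : ∀ {n g} → Hypergraph n g → Fin n → ℕ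
degree {g = g} H v = count (v ∈?_) (tabulate (edge H))

-- A Berge cycle of length ℓ = suc m (with ℓ ≥ 2, i.e. m ≥ 1):
-- distinct vertices v₀,…,v_m, distinct hyperedges e₀,…,e_m with
-- {v_i, v_{i+1}} ⊆ e_i for i < m and {v_m, v_0} ⊆ e_m.
record BergeCycle {n g : ℕ} (H : Hypergraph n g) (m : ℕ) : Set where
  field
    vtx    : Fin (suc m) → Fin n
    edg    : Fin (suc m) → Fin g
    vtx-inj : Injective _≡_ _≡_ vtx
    edg-inj : Injective _≡_ _≡_ edg
    step   : (i : Fin m) → (vtx (inject₁ i) ∈ edge H (edg (inject₁ i)))
                          × (vtx (suc i) ∈ edge H (edg (inject₁ i)))
    close  : (vtx (fromℕ m) ∈ edge H (edg (fromℕ m)))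
           × (vtx zero ∈ edge H (edg (fromℕ m)))

-- girth at least r: no Berge cycle of length ℓ with 2 ≤ ℓ < r
-- (a hypergraph without cycles has infinite girth).
GirthAtLeast : ∀ {n g} → ℕ → Hypergraph n g → Set
GirthAtLeast r H = ∀ m → 1 ≤ m → suc m < r → ¬ BergeCycle H m

detValue : ∀ {n} → ℕ → Subset n → Subset n → ℕ
detValue k h B with ∣ h ∩ B ∣ ≟ 0
... | yes _ = 0
... | no _ with ∣ h ∩ B ∣ ≟ k
...   | yes _ = k
...   | no _ = 1

detectionVector : ∀ {n g} → ℕ → Hypergraph n g → Subset n → Fin g → ℕ
detectionVector k H B i = detValue k (edge H i) B

Detectable : ∀ {n g} → ℕ → ℕ → Hypergraph n g → Set
Detectable {n} k k' H =
  ∀ (B B' : Subset n) → ∣ B ∣ ≡ k' → ∣ B' ∣ ≡ k' →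
  (∀ i → detectionVector k H B i ≡ detectionVector k H B' i) → B ≡ B'

module Submission where

-- Since k ≠ 0, a detection value vanishes exactly when the hyperedge misses
-- the set, so two k'-sets B, B' with equal detection vectors are met by the
-- same hyperedges.  Suppose v ∈ B \ B'.  Each hyperedge through v meets B',
-- and choosing one vertex of B' in each gives deg v distinct "spokes" of v
-- (distinct because two vertices share at most one hyperedge).  Girth ≥ 5
-- forbids triangles and 4-cycles, so two spokes of one vertex are never
-- adjacent and have no common neighbour besides that vertex.  If two spokes
-- u, u' of v lie outside B, their spoke sets into B overlap only in v; if at
-- most one does, v with its spokes in B and the spokes of any u ∈ B' \ B
-- overlap in at most one vertex (and if B' \ B is empty, |B'| < |B|).  Either
-- way two lists of sizes deg x, deg y ≥ k'/2 + 1 fit into B sharing at most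
-- one element, forcing deg x + deg y ≤ k' + 1: a contradiction.

open import Defs
open import Data.Nat using (ℕ; zero; suc; _+_; _*_; _≤_; _<_; s≤s; z≤n)
open import Data.Nat.Properties
  using (≤-trans; ≤-reflexive; ≤-refl; +-comm; +-suc; +-identityʳ; +-mono-≤; +-monoʳ-≤;
         *-distribˡ-+; *-cancelˡ-≤; 1+n≰n; n≮0; <-irrefl; m<n⇒n≢0; module ≤-Reasoning)
  renaming (_≟_ to _≟ℕ_)
open import Data.Fin using (Fin; zero; suc) renaming (_≟_ to _≟ᶠ_)
import Data.Fin.Properties as Fin
open import Data.Fin.Subset using (Subset; _∈_; _∉_; _∩_; _-_; ∣_∣; Nonempty; _⊆_)
open import Data.Fin.Subset.Properties
  using (_∈?_; nonempty?; Empty-unique; ∣⊥∣≡0; x∈p⇒∣p-x∣<∣p∣; x∈p∧x≢y⇒x∈p-y;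
         p⊂q⇒∣p∣<∣q∣; ⊆-antisym; x∈p∩q⁺; x∈p∩q⁻)
open import Data.List using (List; []; _∷_; length; filter; map; _++_; lookup; allFin)
import Data.List as List
import Data.Vec as Vec
open import Data.List.Properties using (filter-all; length-++; length-map)
open import Data.List.Membership.Propositional using (find) renaming (_∈_ to _∈ˡ_; _∉_ to _∉ˡ_)
open import Data.List.Membership.Propositional.Properties using (∈-lookup; ∈-map⁻; ∈-filter⁻; ∈-++⁻)
open import Data.List.Relation.Unary.All as All using (All; []; _∷_)
import Data.List.Relation.Unary.All.Properties as All
open import Data.List.Relation.Unary.Any using (here; there; any?)
open import Data.List.Relation.Unary.AllPairs using ([]; _∷_)
open import Data.List.Relation.Unary.Unique.Propositional using (Unique)
import Data.List.Relation.Unary.Unique.Propositional.Properties as Unique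
open import Data.Empty using (⊥; ⊥-elim)
open import Data.Product using (Σ; _×_; _,_; proj₁; proj₂)
open import Data.Sum using (_⊎_; inj₁; inj₂; [_,_])
open import Function using (_∘_)
open import Function.Definitions using (Injective)
open import Level using (0ℓ)
open import Relation.Binary.PropositionalEquality
  using (_≡_; _≢_; refl; sym; trans; cong; subst; ≢-sym)
open import Relation.Nullary using (¬_; yes; no; ¬?)
open import Relation.Nullary.Decidable using (_×-dec_; decidable-stable)
open import Relation.Unary using (Pred; Decidable)

lookup-injective : ∀ {A : Set} {xs : List A} → Unique xs → Injective _≡_ _≡_ (lookup xs)
lookup-injective {xs = x ∷ xs} _ {zero} {zero} _ = refl
lookup-injective {xs = x ∷ xs} (x∉xs ∷ _) {zero} {suc j} x≡ =
  ⊥-elim (All.lookup x∉xs (∈-lookup j) x≡)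
lookup-injective {xs = x ∷ xs} (x∉xs ∷ _) {suc i} {zero} ≡x =
  ⊥-elim (All.lookup x∉xs (∈-lookup i) (sym ≡x))
lookup-injective {xs = x ∷ xs} (_ ∷ distinct) {suc i} {suc j} eq =
  cong suc (lookup-injective distinct eq)

map⁺-injectiveOn : ∀ {A C : Set} (f : A → C) {xs : List A} → Unique xs →
  (∀ {a b} → a ∈ˡ xs → b ∈ˡ xs → f a ≡ f b → a ≡ b) → Unique (map f xs)
map⁺-injectiveOn f {[]} [] _ = []
map⁺-injectiveOn f {x ∷ xs} (x∉xs ∷ distinct) injective =
  All.map⁺ (All.tabulate λ y∈ fx≡fy → All.lookup x∉xs y∈ (injective (here refl) (there y∈) fx≡fy))
  ∷ map⁺-injectiveOn f distinct (λ a∈ b∈ → injective (there a∈) (there b∈))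

TwoFailing : ∀ {A : Set} → Pred A 0ℓ → List A → Set
TwoFailing {A} Q xs = Σ A λ a → Σ A λ b → a ∈ˡ xs × b ∈ˡ xs × a ≢ b × ¬ Q a × ¬ Q b

twoFailing⊎almostAll : ∀ {A : Set} {Q : Pred A 0ℓ} (Q? : Decidable Q) {xs : List A} →
  Unique xs → TwoFailing Q xs ⊎ length xs ≤ suc (length (filter Q? xs))
twoFailing⊎almostAll Q? {[]} _ = inj₂ z≤n
twoFailing⊎almostAll Q? {x ∷ xs} (x∉xs ∷ distinct) with Q? x | twoFailing⊎almostAll Q? distinct
... | yes _ | inj₁ (a , b , a∈ , b∈ , rest) = inj₁ (a , b , there a∈ , there b∈ , rest)
... | yes _ | inj₂ bound = inj₂ (s≤s bound)
... | no ¬Qx | _ with All.all? Q? xs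
...   | yes allQ = inj₂ (s≤s (≤-reflexive (sym (cong length (filter-all Q? allQ)))))
...   | no ¬allQ with find (All.¬All⇒Any¬ Q? xs ¬allQ)
...     | y , y∈ , ¬Qy = inj₁ (x , y , here refl , there y∈ , All.lookup x∉xs y∈ , ¬Qx , ¬Qy)

pigeonhole : ∀ {n} (S : Subset n) {xs : List (Fin n)} → Unique xs →
  (∀ {z} → z ∈ˡ xs → z ∈ S) → length xs ≤ ∣ S ∣
pigeonhole S {[]} _ _ = z≤n
pigeonhole S {x ∷ xs} (x∉xs ∷ distinct) inS =
  ≤-trans (s≤s (pigeonhole (S - x) distinct inS-x)) (x∈p⇒∣p-x∣<∣p∣ (inS (here refl)))
  where
  inS-x : ∀ {z} → z ∈ˡ xs → z ∈ S - x
  inS-x z∈ = x∈p∧x≢y⇒x∈p-y (inS (there z∈)) (≢-sym (All.lookup x∉xs z∈))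

record ManyIn {n : ℕ} (S : Subset n) (d : ℕ) : Set where
  field
    members  : List (Fin n)
    distinct : Unique members
    inside   : ∀ {y} → y ∈ˡ members → y ∈ S
    large    : d ≤ length members
open ManyIn

AtMostOneCommon : ∀ {A : Set} → List A → List A → Set
AtMostOneCommon xs ys = ∀ {a b} → a ∈ˡ xs → a ∈ˡ ys → b ∈ˡ xs → b ∈ˡ ys → a ≡ b

-- Two lists in S with at most one common entry have total size at most |S| + 1:
-- the entries of Y missing from X, appended to X, form a list in S.
sharedBound : ∀ {n} {S : Subset n} {a b : ℕ} (X : ManyIn S a) (Y : ManyIn S b) →
  AtMostOneCommon (members X) (members Y) → a + b ≤ suc ∣ S ∣
sharedBound {S = S} {a} {b} X Y common = begin
  a + b                           ≤⟨ +-mono-≤ (large X) (large Y) ⟩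
  length xs + length ys           ≤⟨ +-monoʳ-≤ (length xs) mostlyNew ⟩
  length xs + suc (length new)    ≡⟨ +-suc (length xs) (length new) ⟩
  suc (length xs + length new)    ≡⟨ cong suc (length-++ xs) ⟨
  suc (length (xs ++ new))        ≤⟨ s≤s (pigeonhole S merged-distinct merged-inside) ⟩
  suc ∣ S ∣                       ∎
  where
  open ≤-Reasoning
  xs = members X
  ys = members Y
  new? : Decidable (_∉ˡ xs)
  new? y = ¬? (any? (y ≟ᶠ_) xs)
  new = filter new? ys
  mostlyNew : length ys ≤ suc (length new)
  mostlyNew with twoFailing⊎almostAll new? (distinct Y)
  ... | inj₂ bound = bound
  ... | inj₁ (y , y' , y∈ , y'∈ , y≢y' , old , old') =
    ⊥-elim (y≢y' (common (decidable-stable (any? (y ≟ᶠ_) xs) old) y∈ (decidable-stable (any? (y' ≟ᶠ_) xs) old') y'∈))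
  merged-distinct : Unique (xs ++ new)
  merged-distinct = Unique.++⁺ (distinct X) (Unique.filter⁺ new? (distinct Y))
                      (λ (y∈xs , y∈new) → proj₂ (∈-filter⁻ new? {xs = ys} y∈new) y∈xs)
  merged-inside : ∀ {z} → z ∈ˡ xs ++ new → z ∈ S
  merged-inside z∈ = [ inside X , inside Y ∘ proj₁ ∘ ∈-filter⁻ new? {xs = ys} ] (∈-++⁻ xs z∈)

degreeSum : ∀ {k' a b} → k' + 2 ≤ 2 * a → k' + 2 ≤ 2 * b → k' + 2 ≤ a + b
degreeSum {k'} {a} {b} ha hb = *-cancelˡ-≤ 2 (begin
  2 * (k' + 2)              ≡⟨ cong ((k' + 2) +_) (+-identityʳ (k' + 2)) ⟩
  (k' + 2) + (k' + 2)       ≤⟨ +-mono-≤ ha hb ⟩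
  2 * a + 2 * b             ≡⟨ *-distribˡ-+ 2 a b ⟨
  2 * (a + b)               ∎)
  where open ≤-Reasoning

length-filter-tabulate : ∀ {A C : Set} m (j : Fin m → C) (f : C → A) {P : Pred A 0ℓ} (P? : Decidable P) →
  length (filter (P? ∘ f) (List.tabulate j)) ≡ Vec.count P? (Vec.tabulate (f ∘ j))
length-filter-tabulate zero j f P? = refl
length-filter-tabulate (suc m) j f P? with P? (f (j zero))
... | yes _ = cong suc (length-filter-tabulate m (j ∘ suc) f P?)
... | no _ = length-filter-tabulate m (j ∘ suc) f P?

incident : ∀ {n g} → Hypergraph n g → Fin n → List (Fin g)
incident {g = g} H v = filter (λ e → v ∈? edge H e) (allFin g)

incident-distinct : ∀ {n g} (H : Hypergraph n g) v → Unique (incident H v)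
incident-distinct {g = g} H v = Unique.filter⁺ (λ e → v ∈? edge H e) (Unique.allFin⁺ g)

∈-incident : ∀ {n g} (H : Hypergraph n g) {v e} → e ∈ˡ incident H v → v ∈ edge H e
∈-incident {g = g} H {v} e∈ = proj₂ (∈-filter⁻ (λ e → v ∈? edge H e) {xs = allFin g} e∈)

length-incident : ∀ {n g} (H : Hypergraph n g) v → length (incident H v) ≡ degree H v
length-incident {g = g} H v = length-filter-tabulate g (λ e → e) (edge H) (v ∈?_)

nonempty⇒∣∣≢0 : ∀ {n} {p : Subset n} → Nonempty p → ∣ p ∣ ≢ 0
nonempty⇒∣∣≢0 {p = p} (x , x∈p) ∣p∣≡0 = n≮0 (subst (∣ p - x ∣ <_) ∣p∣≡0 (x∈p⇒∣p-x∣<∣p∣ x∈p))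

empty⇒∣∣≡0 : ∀ {n} {p : Subset n} → ¬ Nonempty p → ∣ p ∣ ≡ 0
empty⇒∣∣≡0 {n} empty = trans (cong ∣_∣ (Empty-unique empty)) (∣⊥∣≡0 n)

miss⇒detValue≡0 : ∀ {n} k (h B : Subset n) → ∣ h ∩ B ∣ ≡ 0 → detValue k h B ≡ 0
miss⇒detValue≡0 k h B miss with ∣ h ∩ B ∣ ≟ℕ 0
... | yes _ = refl
... | no hits = ⊥-elim (hits miss)

detValue≡0⇒miss : ∀ {n} {k} (h B : Subset n) → k ≢ 0 → detValue k h B ≡ 0 → ∣ h ∩ B ∣ ≡ 0
detValue≡0⇒miss {k = k} h B k≢0 value≡0 with ∣ h ∩ B ∣ ≟ℕ 0
... | yes miss = miss
... | no _ with ∣ h ∩ B ∣ ≟ℕ k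
...   | yes _ = ⊥-elim (k≢0 value≡0)
...   | no _ = ⊥-elim (1+n≰n (≤-reflexive value≡0))

meets-transfer : ∀ {n} {k} (h B B' : Subset n) → k ≢ 0 →
  detValue k h B ≡ detValue k h B' → Nonempty (h ∩ B) → Nonempty (h ∩ B')
meets-transfer h B B' k≢0 same meetsB with nonempty? (h ∩ B')
... | yes meetsB' = meetsB'
... | no missesB' = ⊥-elim (nonempty⇒∣∣≢0 meetsB
        (detValue≡0⇒miss h B k≢0 (trans same (miss⇒detValue≡0 _ h B' (empty⇒∣∣≡0 missesB')))))

pick : ∀ {n} → Subset n → Fin n → Fin n
pick p d with nonempty? p
... | yes (x , _) = x
... | no _ = d

pick∈ : ∀ {n} {p : Subset n} {d} → Nonempty p → pick p d ∈ p
pick∈ {p = p} nonempty with nonempty? p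
... | yes (_ , x∈p) = x∈p
... | no empty = ⊥-elim (empty nonempty)

module GirthFive {n g : ℕ} (H : Hypergraph n g) (girth : GirthAtLeast 5 H) where

  _∈e_ : Fin n → Fin g → Set
  x ∈e a = x ∈ edge H a

  noShortCycle : ∀ m → 1 ≤ m → m ≤ 3 → ¬ BergeCycle H m
  noShortCycle m 1≤m m≤3 = girth m 1≤m (s≤s (s≤s m≤3))

  no2Cycle : ∀ {x y a b} → Unique (x ∷ y ∷ []) → Unique (a ∷ b ∷ []) →
    x ∈e a → y ∈e a → y ∈e b → x ∈e b → ⊥
  no2Cycle {x} {y} {a} {b} vs es xa ya yb xb = noShortCycle 1 ≤-refl (s≤s z≤n) record
    { vtx = lookup (x ∷ y ∷ []) ; edg = lookup (a ∷ b ∷ [])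
    ; vtx-inj = lookup-injective vs ; edg-inj = lookup-injective es
    ; step = λ { zero → xa , ya } ; close = yb , xb }

  no3Cycle : ∀ {x y z a b c} → Unique (x ∷ y ∷ z ∷ []) → Unique (a ∷ b ∷ c ∷ []) →
    x ∈e a → y ∈e a → y ∈e b → z ∈e b → z ∈e c → x ∈e c → ⊥
  no3Cycle {x} {y} {z} {a} {b} {c} vs es xa ya yb zb zc xc =
    noShortCycle 2 (s≤s z≤n) (s≤s (s≤s z≤n)) record
      { vtx = lookup (x ∷ y ∷ z ∷ []) ; edg = lookup (a ∷ b ∷ c ∷ [])
      ; vtx-inj = lookup-injective vs ; edg-inj = lookup-injective es
      ; step = λ { zero → xa , ya ; (suc zero) → yb , zb } ; close = zc , xc }

  no4Cycle : ∀ {x y z w a b c d} → Unique (x ∷ y ∷ z ∷ w ∷ []) → Unique (a ∷ b ∷ c ∷ d ∷ []) →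
    x ∈e a → y ∈e a → y ∈e b → z ∈e b → z ∈e c → w ∈e c → w ∈e d → x ∈e d → ⊥
  no4Cycle {x} {y} {z} {w} {a} {b} {c} {d} vs es xa ya yb zb zc wc wd xd =
    noShortCycle 3 (s≤s z≤n) ≤-refl record
      { vtx = lookup (x ∷ y ∷ z ∷ w ∷ []) ; edg = lookup (a ∷ b ∷ c ∷ d ∷ [])
      ; vtx-inj = lookup-injective vs ; edg-inj = lookup-injective es
      ; step = λ { zero → xa , ya ; (suc zero) → yb , zb ; (suc (suc zero)) → zc , wc }
      ; close = wd , xd }

  sharedEdgeUnique : ∀ {x y a b} → x ≢ y → x ∈e a → y ∈e a → x ∈e b → y ∈e b → a ≡ b
  sharedEdgeUnique {a = a} {b} x≢y xa ya xb yb with a ≟ᶠ b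
  ... | yes a≡b = a≡b
  ... | no a≢b = ⊥-elim (no2Cycle ((x≢y ∷ []) ∷ [] ∷ []) ((a≢b ∷ []) ∷ [] ∷ []) xa ya yb xb)

  noTriangle : ∀ {x y z a b c} → x ≢ y → y ≢ z → x ≢ z → a ≢ b →
    x ∈e a → y ∈e a → y ∈e b → z ∈e b → z ∈e c → x ∈e c → ⊥
  noTriangle {a = a} {b} {c} x≢y y≢z x≢z a≢b xa ya yb zb zc xc with a ≟ᶠ c | b ≟ᶠ c
  ... | yes refl | _ = a≢b (sharedEdgeUnique y≢z ya zc yb zb)
  ... | no _ | yes refl = a≢b (sharedEdgeUnique x≢y xa ya xc yb)
  ... | no a≢c | no b≢c =
    no3Cycle ((x≢y ∷ x≢z ∷ []) ∷ (y≢z ∷ []) ∷ [] ∷ []) ((a≢b ∷ a≢c ∷ []) ∷ (b≢c ∷ []) ∷ [] ∷ [])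
      xa ya yb zb zc xc

  -- Distinct x, z are joined by at most one path x –e₁– y₁ –f₁– z, up to the first edge:
  -- two such paths with distinct middles y₁ ≠ y₂ and distinct first edges e₁ ≠ e₂ close
  -- a cycle of length at most 4.
  noTwoPaths : ∀ {x z y₁ y₂ e₁ e₂ f₁ f₂} → x ≢ z → y₁ ≢ y₂ →
    y₁ ≢ x → y₁ ≢ z → y₂ ≢ x → y₂ ≢ z → e₁ ≢ e₂ →
    x ∈e e₁ → y₁ ∈e e₁ → y₁ ∈e f₁ → z ∈e f₁ →
    x ∈e e₂ → y₂ ∈e e₂ → y₂ ∈e f₂ → z ∈e f₂ → ⊥
  noTwoPaths {e₁ = e₁} {e₂} {f₁} {f₂} x≢z y₁≢y₂ y₁≢x y₁≢z y₂≢x y₂≢z e₁≢e₂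
    xe₁ y₁e₁ y₁f₁ zf₁ xe₂ y₂e₂ y₂f₂ zf₂ with f₁ ≟ᶠ f₂
  ... | yes refl = noTriangle y₁≢x (≢-sym y₂≢x) y₁≢y₂ e₁≢e₂ y₁e₁ xe₁ xe₂ y₂e₂ y₂f₂ y₁f₁
  ... | no f₁≢f₂ with e₁ ≟ᶠ f₁ | e₂ ≟ᶠ f₂ | e₁ ≟ᶠ f₂ | e₂ ≟ᶠ f₁
  ...   | yes refl | _ | _ | _ =
    noTriangle (≢-sym x≢z) (≢-sym y₂≢x) (≢-sym y₂≢z) e₁≢e₂ zf₁ xe₁ xe₂ y₂e₂ y₂f₂ zf₂
  ...   | no _ | yes refl | _ | _ =
    noTriangle (≢-sym x≢z) (≢-sym y₁≢x) (≢-sym y₁≢z) (≢-sym e₁≢e₂) zf₂ xe₂ xe₁ y₁e₁ y₁f₁ zf₁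
  ...   | no _ | no _ | yes refl | _ = e₁≢e₂ (sharedEdgeUnique (≢-sym y₂≢x) xe₁ y₂f₂ xe₂ y₂e₂)
  ...   | no _ | no _ | no _ | yes refl = e₁≢e₂ (sharedEdgeUnique (≢-sym y₁≢x) xe₁ y₁e₁ xe₂ y₁f₁)
  ...   | no e₁≢f₁ | no e₂≢f₂ | no e₁≢f₂ | no e₂≢f₁ =
    no4Cycle ((≢-sym y₁≢x ∷ x≢z ∷ ≢-sym y₂≢x ∷ []) ∷ (y₁≢z ∷ y₁≢y₂ ∷ []) ∷ (≢-sym y₂≢z ∷ []) ∷ [] ∷ [])
             ((e₁≢f₁ ∷ e₁≢f₂ ∷ e₁≢e₂ ∷ []) ∷ (f₁≢f₂ ∷ ≢-sym e₂≢f₁ ∷ []) ∷ (≢-sym e₂≢f₂ ∷ []) ∷ [] ∷ [])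
             xe₁ y₁e₁ y₁f₁ zf₁ zf₂ y₂f₂ y₂e₂ xe₂

  -- Spokes from x into S: distinct vertices of S, one chosen in each hyperedge
  -- through x, so each is joined to x by its own hyperedge.
  record Spokes (x : Fin n) (S : Subset n) : Set where
    field
      tips          : List (Fin n)
      distinct-tips : Unique tips
      tip∈S         : ∀ {y} → y ∈ˡ tips → y ∈ S
      enough        : degree H x ≤ length tips
      via           : ∀ {y} → y ∈ˡ tips → Fin g
      x∈via         : ∀ {y} (p : y ∈ˡ tips) → x ∈e via p
      y∈via         : ∀ {y} (p : y ∈ˡ tips) → y ∈e via p
      via-injective : ∀ {y y'} (p : y ∈ˡ tips) (p' : y' ∈ˡ tips) → via p ≡ via p' → y ≡ y'
      tip≢x         : ∀ {y} → y ∈ˡ tips → y ≢ x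
  open Spokes

  spokeCrowd : ∀ {x S} → Spokes x S → ManyIn S (degree H x)
  spokeCrowd N = record
    { members = tips N ; distinct = distinct-tips N ; inside = tip∈S N ; large = enough N }

  spokes : ∀ {x S} → x ∉ S → (∀ e → x ∈e e → Nonempty (edge H e ∩ S)) → Spokes x S
  spokes {x} {S} x∉S meets = record
    { tips = map tip (incident H x)
    ; distinct-tips = map⁺-injectiveOn tip (incident-distinct H x) tip-injective
    ; tip∈S = λ p → proj₂ (tip-spec p)
    ; enough = ≤-reflexive (trans (sym (length-incident H x)) (sym (length-map tip (incident H x))))
    ; via = λ p → proj₁ (∈-map⁻ tip p)
    ; x∈via = λ p → ∈-incident H (proj₁ (proj₂ (∈-map⁻ tip p)))
    ; y∈via = λ p → proj₁ (tip-spec p)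
    ; via-injective = λ p p' via≡ →
        trans (proj₂ (proj₂ (∈-map⁻ tip p))) (trans (cong tip via≡) (sym (proj₂ (proj₂ (∈-map⁻ tip p')))))
    ; tip≢x = λ p y≡x → x∉S (subst (_∈ S) y≡x (proj₂ (tip-spec p)))
    }
    where
    tip : Fin g → Fin n
    tip e = pick (edge H e ∩ S) x

    tip∈ : ∀ {e} → e ∈ˡ incident H x → tip e ∈e e × tip e ∈ S
    tip∈ e∈ = x∈p∩q⁻ _ S (pick∈ (meets _ (∈-incident H e∈)))

    tip-spec : ∀ {y} (p : y ∈ˡ map tip (incident H x)) → y ∈e proj₁ (∈-map⁻ tip p) × y ∈ S
    tip-spec p with ∈-map⁻ tip p
    ... | _ , e∈ , refl = tip∈ e∈

    tip-injective : ∀ {a b} → a ∈ˡ incident H x → b ∈ˡ incident H x → tip a ≡ tip b → a ≡ b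
    tip-injective a∈ b∈ tip≡ =
      sharedEdgeUnique (λ x≡ → x∉S (subst (_∈ S) (sym x≡) (proj₂ (tip∈ a∈))))
        (∈-incident H a∈) (proj₁ (tip∈ a∈)) (∈-incident H b∈) (subst (_∈e _) (sym tip≡) (proj₁ (tip∈ b∈)))

  spokesInto : ∀ {v} {S T : Subset n} → v ∈ S → v ∉ T →
    (∀ e → Nonempty (edge H e ∩ S) → Nonempty (edge H e ∩ T)) → Spokes v T
  spokesInto {v} v∈S v∉T S⇒T = spokes v∉T (λ e v∈e → S⇒T e (v , x∈p∩q⁺ (v∈e , v∈S)))

  -- Two distinct spoke tips of x share no hyperedge (that would be a triangle through x).
  tipsNotAdjacent : ∀ {x S y₁ y₂ c} (N : Spokes x S) (p : y₁ ∈ˡ tips N) (q : y₂ ∈ˡ tips N) →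
    y₁ ≢ y₂ → y₁ ∈e c → y₂ ∈e c → ⊥
  tipsNotAdjacent N p q y₁≢y₂ y₁c y₂c =
    noTriangle (tip≢x N p) (≢-sym (tip≢x N q)) y₁≢y₂ (y₁≢y₂ ∘ via-injective N p q)
      (y∈via N p) (x∈via N p) (x∈via N q) (y∈via N q) y₂c y₁c

  noCommonNeighbour : ∀ {x S y₁ y₂ z f₁ f₂} (N : Spokes x S) (p : y₁ ∈ˡ tips N) (q : y₂ ∈ˡ tips N) →
    y₁ ≢ y₂ → z ≢ x → z ≢ y₁ → z ≢ y₂ → y₁ ∈e f₁ → z ∈e f₁ → y₂ ∈e f₂ → z ∈e f₂ → ⊥
  noCommonNeighbour N p q y₁≢y₂ z≢x z≢y₁ z≢y₂ y₁f₁ zf₁ y₂f₂ zf₂ =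
    noTwoPaths (≢-sym z≢x) y₁≢y₂ (tip≢x N p) (≢-sym z≢y₁) (tip≢x N q) (≢-sym z≢y₂)
      (y₁≢y₂ ∘ via-injective N p q)
      (x∈via N p) (y∈via N p) y₁f₁ zf₁ (x∈via N q) (y∈via N q) y₂f₂ zf₂

  module SameTraces (k' : ℕ) (deg : ∀ v → k' + 2 ≤ 2 * degree H v)
    (B B' : Subset n) (∣B∣≡k' : ∣ B ∣ ≡ k') (∣B'∣≡k' : ∣ B' ∣ ≡ k')
    (B⇒B' : ∀ e → Nonempty (edge H e ∩ B) → Nonempty (edge H e ∩ B'))
    (B'⇒B : ∀ e → Nonempty (edge H e ∩ B') → Nonempty (edge H e ∩ B)) where

    crowded : ∀ {x y} (X : ManyIn B (degree H x)) (Y : ManyIn B (degree H y)) →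
      AtMostOneCommon (members X) (members Y) → ⊥
    crowded {x} {y} X Y common = 1+n≰n (begin
      suc (suc k')              ≡⟨ +-comm 2 k' ⟩
      k' + 2                    ≤⟨ degreeSum {k'} {degree H x} {degree H y} (deg x) (deg y) ⟩
      degree H x + degree H y   ≤⟨ sharedBound X Y common ⟩
      suc ∣ B ∣                 ≡⟨ cong suc ∣B∣≡k' ⟩
      suc k'                    ∎)
      where open ≤-Reasoning

    -- Two spokes u ≠ u' of v outside B: their spokes into B meet only in v.
    twoOutside : ∀ {v u u'} (Nv : Spokes v B') → u ∈ˡ tips Nv → u' ∈ˡ tips Nv →
      u ≢ u' → u ∉ B → u' ∉ B → ⊥
    twoOutside {v} Nv p p' u≢u' u∉B u'∉B = crowded (spokeCrowd Nu) (spokeCrowd Nu') common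
      where
      Nu = spokesInto (tip∈S Nv p) u∉B B'⇒B
      Nu' = spokesInto (tip∈S Nv p') u'∉B B'⇒B
      onlyV : ∀ {a} → a ∈ˡ tips Nu → a ∈ˡ tips Nu' → a ≡ v
      onlyV {a} q q' with a ≟ᶠ v
      ... | yes a≡v = a≡v
      ... | no a≢v = ⊥-elim (noCommonNeighbour Nv p p' u≢u' a≢v (tip≢x Nu q) (tip≢x Nu' q')
                                (x∈via Nu q) (y∈via Nu q) (x∈via Nu' q') (y∈via Nu' q'))
      common : AtMostOneCommon (tips Nu) (tips Nu')
      common q q' r r' = trans (onlyV q q') (sym (onlyV r r'))

    -- At most one spoke of v outside B: v with its spokes in B is a crowd in B
    -- meeting the spokes into B of any u ∈ B' \ B in at most one vertex.
    oneOutside : ∀ {v u} → v ∈ B → (Nv : Spokes v B') →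
      length (tips Nv) ≤ suc (length (filter (_∈? B) (tips Nv))) → u ∈ B' → u ∉ B → ⊥
    oneOutside {v} {u} v∈B Nv almostAll u∈B' u∉B = crowded V (spokeCrowd Nu) common
      where
      Nu = spokesInto u∈B' u∉B B'⇒B
      inB = filter (_∈? B) (tips Nv)
      fromTips : ∀ {b} → b ∈ˡ inB → b ∈ˡ tips Nv
      fromTips b∈ = proj₁ (∈-filter⁻ (_∈? B) {xs = tips Nv} b∈)
      b≢u : ∀ {b} → b ∈ˡ inB → b ≢ u
      b≢u b∈ b≡u = u∉B (subst (_∈ B) b≡u (proj₂ (∈-filter⁻ (_∈? B) {xs = tips Nv} b∈)))
      u≢v : u ≢ v
      u≢v u≡v = u∉B (subst (_∈ B) (sym u≡v) v∈B)
      V : ManyIn B (degree H v)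
      V = record
        { members = v ∷ inB
        ; distinct = All.tabulate (λ b∈ v≡b → tip≢x Nv (fromTips b∈) (sym v≡b))
                     ∷ Unique.filter⁺ (_∈? B) (distinct-tips Nv)
        ; inside = λ { (here refl) → v∈B ; (there b∈) → proj₂ (∈-filter⁻ (_∈? B) {xs = tips Nv} b∈) }
        ; large = ≤-trans (enough Nv) almostAll }
      vAndTip : ∀ {b} → v ∈ˡ tips Nu → b ∈ˡ inB → b ∈ˡ tips Nu → ⊥
      vAndTip q b∈ r = tipsNotAdjacent Nu q r (tip≢x Nv (fromTips b∈) ∘ sym)
                         (x∈via Nv (fromTips b∈)) (y∈via Nv (fromTips b∈))
      common : AtMostOneCommon (v ∷ inB) (tips Nu)
      common (here refl) _ (here refl) _ = refl
      common (here refl) q (there b∈) r = ⊥-elim (vAndTip q b∈ r)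
      common (there a∈) q (here refl) r = ⊥-elim (vAndTip r a∈ q)
      common {a} {b} (there a∈) q (there b∈) r with a ≟ᶠ b
      ... | yes a≡b = a≡b
      ... | no a≢b = ⊥-elim (noCommonNeighbour Nv (fromTips a∈) (fromTips b∈) a≢b
                        u≢v (≢-sym (b≢u a∈)) (≢-sym (b≢u b∈))
                        (y∈via Nu q) (x∈via Nu q) (y∈via Nu r) (x∈via Nu r))

    -- No vertex v of B lies outside B': according to how many spokes of v fall
    -- outside B, and whether B' \ B is empty (then B' ⊊ B contradicts |B'| = |B|).
    notOutside : ∀ {v} → v ∈ B → v ∉ B' → Spokes v B' → ⊥
    notOutside {v} v∈B v∉B' Nv with twoFailing⊎almostAll (_∈? B) (distinct-tips Nv)
      | Fin.any? (λ u → (u ∈? B') ×-dec ¬? (u ∈? B))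
    ... | inj₁ (u , u' , p , p' , u≢u' , u∉B , u'∉B) | _ = twoOutside Nv p p' u≢u' u∉B u'∉B
    ... | inj₂ almostAll | yes (u , u∈B' , u∉B) = oneOutside v∈B Nv almostAll u∈B' u∉B
    ... | inj₂ _ | no noNewVertex =
      <-irrefl (trans ∣B'∣≡k' (sym ∣B∣≡k')) (p⊂q⇒∣p∣<∣q∣ (B'⊆B , v , v∈B , v∉B'))
      where
      B'⊆B : B' ⊆ B
      B'⊆B {u} u∈B' = decidable-stable (u ∈? B) (λ u∉B → noNewVertex (u , u∈B' , u∉B))

    B⊆B' : B ⊆ B'
    B⊆B' {v} v∈B with v ∈? B'
    ... | yes v∈B' = v∈B'
    ... | no v∉B' = ⊥-elim (notOutside v∈B v∉B' (spokesInto v∈B v∉B' B⇒B'))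

mainTheorem7 : (k k' : ℕ) → 1 ≤ k' → k' ≤ k →
    ∀ {n g} (H : Hypergraph n g) → Uniform k H →
    (∀ v → k' + 2 ≤ 2 * degree H v) →
    GirthAtLeast 5 H →
    Detectable k k' H
-- Equal detection vectors give the same meeting hyperedges in both directions,
-- so the core lemma yields B ⊆ B' and B' ⊆ B.
mainTheorem7 k k' 1≤k' k'≤k H _ deg girth B B' ∣B∣≡k' ∣B'∣≡k' sameVector =
  ⊆-antisym (included B B' ∣B∣≡k' ∣B'∣≡k' sameVector)
            (included B' B ∣B'∣≡k' ∣B∣≡k' (sym ∘ sameVector))
  where
  open GirthFive H girth

  k≢0 : k ≢ 0
  k≢0 = m<n⇒n≢0 (≤-trans 1≤k' k'≤k)

  sameMeets : ∀ {C C'} → (∀ i → detectionVector k H C i ≡ detectionVector k H C' i) →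
    ∀ e → Nonempty (edge H e ∩ C) → Nonempty (edge H e ∩ C')
  sameMeets {C} {C'} same e = meets-transfer (edge H e) C C' k≢0 (same e)

  included : ∀ C C' → ∣ C ∣ ≡ k' → ∣ C' ∣ ≡ k' →
    (∀ i → detectionVector k H C i ≡ detectionVector k H C' i) → C ⊆ C'
  included C C' ∣C∣≡k' ∣C'∣≡k' same =
    SameTraces.B⊆B' k' deg C C' ∣C∣≡k' ∣C'∣≡k' (sameMeets same) (sameMeets (sym ∘ same))
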